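{- Let $\mathbf i$ be a double reduced word for $(u,v)$ and $B$ the exchange matrix of the seed $\Sigma_{\mathbf i}$. Then the submatrix of $B$ formed by its unfrozen rows (rows indexed by $I\setminus I_0$, all columns) has full rank.
   Context: $C=(C_{ij})_{1\le i,j\le r}$ is a symmetrizable generalized Cartan matrix, $\tilde r=2r-\operatorname{rank}C$, and $C_{ij}$ is extended to $1\le i,j\le\tilde r$ as follows: fix a basis $\omega_1,\dots,\omega_{\tilde r}$ of the weight lattice with $\langle\omega_j|\alpha_i^\vee\rangle=\delta_{ij}$ for $i\le r$, let $\alpha_i^\vee$ ($1\le i\le\tilde r$) be the dual basis, define $C_{ij}$ ($i>r$, $j\le r$) by $\alpha_j=\sum_iC_{ij}\omega_i$, for $i>r$ set $\alpha_i=D\sum_{j\le r}d_j^{ -1}C_{ij}\omega_j$ with $d_j$ the symmetrizers and $D$ their lcm, and put $C_{ij}=\langle\alpha_j|\alpha_i^\vee\rangle$. $W$ is the Weyl group with length $\ell$. A double reduced word for $(u,v)$ is a shuffle $\mathbf i=(i_1,\dots,i_m)$, $m=\ell(u)+\ell(v)$, of a reduced word for $u$ in $\{ -1,\dots,-r\}$ and one for $v$ in $\{1,\dots,r\}$. $I=\{ -\tilde r,\dots,-1\}\cup\{1,\dots,m\}$, $i_k=k$ for $k<0$, $\varepsilon_k$ the sign of $i_k$, $\varepsilon_{m+1}=1$, $k^+=\min\{\ell\in I:\ell>k,|i_\ell|=|i_k|\}$ (or $m+1$ if none), $[P]\in\{0,1\}$ the truth value. Seed $\Sigma_{\mathbf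 i}$: frozen set $I_0=\{k\in I:k<0\text{ or }k^+>m\}$, exchange matrix $b_{jk}=\tfrac{C_{|i_k|,|i_j|}}{2}(\varepsilon_j[j=k^+]-\varepsilon_k[j^+=k]+\varepsilon_j[k<j<k^+][j>0]-\varepsilon_{j^+}[k<j^+<k^+][j^+\le m]-\varepsilon_k[j<k<j^+][k>0]+\varepsilon_{k^+}[j<k^+<j^+][k^+\le m])$ for $j,k\in I$. -}

module Defs where

open import Data.Bool using (Bool; true; false; if_then_else_; _∧_)
open import Data.Nat as ℕ using (ℕ; zero; suc; NonZero)
open import Data.Nat.LCM using (lcm)
open import Data.Integer as ℤ using (ℤ; +_; -[1+_]; +[1+_])
open import Data.Rational as ℚ using (ℚ; 0ℚ)
open import Data.Fin as Fin using (Fin; splitAt; fromℕ<; toℕ)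
open import Data.List using (List; []; _∷_; length; map; upTo; foldr)
open import Data.Maybe using (Maybe; just; nothing; maybe)
open import Data.Product using (Σ; _×_; _,_)
open import Data.Sum using (_⊎_; inj₁; inj₂)
open import Relation.Nullary using (¬_; Dec; yes; no)
open import Relation.Nullary.Decidable using (⌊_⌋)
open import Relation.Binary.PropositionalEquality using (_≡_)

∑ℤ : ∀ {n} → (Fin n → ℤ) → ℤ
∑ℤ {zero}  f = + 0
∑ℤ {suc n} f = f Fin.zero ℤ.+ ∑ℤ (λ i → f (Fin.suc i))

∑ℚ : ∀ {n} → (Fin n → ℚ) → ℚ
∑ℚ {zero}  f = 0ℚ
∑ℚ {suc n} f = f Fin.zero ℚ.+ ∑ℚ (λ i → f (Fin.suc i))

⟪_⟫ : ℤ → ℚ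
⟪ z ⟫ = z ℚ./ 1

LinIndepCols : ∀ {a b k} → (Fin a → Fin b → ℤ) → (Fin k → Fin b) → Set
LinIndepCols {a} {b} {k} M cols =
  ∀ (x : Fin k → ℚ) →
  (∀ i → ∑ℚ (λ l → ⟪ M i (cols l) ⟫ ℚ.* x l) ≡ 0ℚ) →
  ∀ l → x l ≡ 0ℚ

HasRank : ∀ {a b} → (Fin a → Fin b → ℤ) → ℕ → Set
HasRank {a} {b} M ρ =
  Σ (Fin ρ → Fin b) (λ cols → LinIndepCols M cols) ×
  (∀ (cols : Fin (suc ρ) → Fin b) → ¬ LinIndepCols M cols)

IsGCM : ∀ r → (Fin r → Fin r → ℤ) → Set
IsGCM r C =
  (∀ i → C i i ≡ + 2) ×
  (∀ i j → ¬ (i ≡ j) → C i j ℤ.≤ + 0) ×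
  (∀ i j → C i j ≡ + 0 → C j i ≡ + 0)

IsSymmetrizer : ∀ r → (Fin r → Fin r → ℤ) → (Fin r → ℕ) → Set
IsSymmetrizer r C d =
  (∀ i → NonZero (d i)) ×
  (∀ i j → + (d i) ℤ.* C i j ≡ + (d j) ℤ.* C j i)

lcmAll : ∀ {r} → (Fin r → ℕ) → ℕ
lcmAll {zero}  d = 1
lcmAll {suc r} d = lcm (d Fin.zero) (lcmAll (λ i → d (Fin.suc i)))

-- The stacked r̃×r matrix of coefficients of α_j (j ≤ r) in the basis ω:
-- top block C, bottom block E (the rows i > r).
stacked : ∀ {r n} → (Fin r → Fin r → ℤ) → (Fin n → Fin r → ℤ) →
          Fin (r ℕ.+ n) → Fin r → ℤ
stacked {r} C E i j with splitAt r i
... | inj₁ a = C a j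
... | inj₂ a = E a j

-- Extended matrix C_ij, 1 ≤ i,j ≤ r̃ = r + n  (index Fin-value t ↔ label t+1)
extC : ∀ {r n} → (C : Fin r → Fin r → ℤ) → (E : Fin n → Fin r → ℤ) →
       (d : Fin r → ℕ) → (∀ i → NonZero (d i)) →
       Fin (r ℕ.+ n) → Fin (r ℕ.+ n) → ℤ
extC {r} C E d nz i j with splitAt r i | splitAt r j
... | inj₁ a | inj₁ b = C a b
... | inj₂ a | inj₁ b = E a b
... | inj₁ a | inj₂ b =
      + (ℕ._/_ (lcmAll d) (d a) {{nz a}}) ℤ.* E b a
... | inj₂ a | inj₂ b = + 0

-- Weyl group via its (faithful) action on the root lattice ℤ^r
-- (coordinates w.r.t. the simple roots):  s_i(x) = x - ⟨x|α_i^∨⟩ α_i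

reflect : ∀ {r} → (Fin r → Fin r → ℤ) → Fin r → (Fin r → ℤ) → (Fin r → ℤ)
reflect C i x l with l Fin.≟ i
... | yes _ = x l ℤ.- ∑ℤ (λ j → C i j ℤ.* x j)
... | no  _ = x l

act : ∀ {r} → (Fin r → Fin r → ℤ) → List (Fin r) → (Fin r → ℤ) → (Fin r → ℤ)
act C []      x = x
act C (i ∷ w) x = reflect C i (act C w x)

SameElement : ∀ {r} → (Fin r → Fin r → ℤ) → List (Fin r) → List (Fin r) → Set
SameElement C w w' = ∀ x l → act C w x l ≡ act C w' x l

Reduced : ∀ {r} → (Fin r → Fin r → ℤ) → List (Fin r) → Set
Reduced C w = ∀ w' → SameElement C w w' → length w ℕ.≤ length w'

-- Double words.  neg i  is the letter -(i+1),  pos i  the letter i+1.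

data Letter (r : ℕ) : Set where
  neg pos : Fin r → Letter r

negPart : ∀ {r} → List (Letter r) → List (Fin r)
negPart []            = []
negPart (neg i ∷ w) = i ∷ negPart w
negPart (pos _ ∷ w) = negPart w

posPart : ∀ {r} → List (Letter r) → List (Fin r)
posPart []            = []
posPart (neg _ ∷ w) = posPart w
posPart (pos i ∷ w) = i ∷ posPart w

DoubleReduced : ∀ {r} → (Fin r → Fin r → ℤ) → List (Letter r) → Set
DoubleReduced C w = Reduced C (negPart w) × Reduced C (posPart w)

absL : ∀ {r} → Letter r → ℕ
absL (neg i) = toℕ i
absL (pos i) = toℕ i

sgnL : ∀ {r} → Letter r → ℤ
sgnL (neg _) = ℤ.-[1+ 0 ]
sgnL (pos _) = + 1

nth : ∀ {A : Set} → List A → ℕ → Maybe A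
nth []      _       = nothing
nth (x ∷ _) zero    = just x
nth (_ ∷ xs) (suc p) = nth xs p

module Seed {r : ℕ} (w : List (Letter r)) where

  m : ℕ
  m = length w

  -- |i_k| - 1  (so labels 0 … r̃-1); for k < 0, i_k = k
  absI : ℤ → ℕ
  absI -[1+ p ]  = p
  absI (+ zero)  = 0                        -- 0 ∉ I, unused
  absI +[1+ p ]  = maybe absL 0 (nth w p)   -- p ≥ m unused

  ε : ℤ → ℤ
  ε -[1+ _ ]  = ℤ.-[1+ 0 ]
  ε (+ zero)  = + 1                         -- unused
  ε +[1+ p ]  = maybe sgnL (+ 1) (nth w p)  -- gives ε_{m+1} = 1

  positions : List ℤ
  positions = map (λ p → +[1+ p ]) (upTo m)

  firstSuch : (ℤ → Bool) → List ℤ → ℤ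
  firstSuch P []       = + suc m
  firstSuch P (l ∷ ls) = if P l then l else firstSuch P ls

  _⁺ : ℤ → ℤ
  k ⁺ = firstSuch (λ l → ⌊ k ℤ.<? l ⌋ ∧ ⌊ absI l ℕ.≟ absI k ⌋) positions

  InI : ℕ → ℤ → Set
  InI rt k = (k ℤ.< + 0 × ℤ.- (+ rt) ℤ.≤ k) ⊎ (+ 0 ℤ.< k × k ℤ.≤ + m)

  Frozen : ℤ → Set
  Frozen k = k ℤ.< + 0 ⊎ + m ℤ.< k ⁺

  -- position j : Fin m stands for the index j+1 ∈ I
  idx : Fin m → ℤ
  idx j = +[1+ toℕ j ]

  ⟦_⟧ : ∀ {P : Set} → Dec P → ℤ
  ⟦ yes _ ⟧ = + 1
  ⟦ no  _ ⟧ = + 0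

  -- entry C_{ab} of an r̃×r̃ matrix at 0-based labels a, b
  entry : ∀ {rt} → (Fin rt → Fin rt → ℤ) → ℕ → ℕ → ℤ
  entry {rt} M a b with a ℕ.<? rt | b ℕ.<? rt
  ... | yes p | yes q = M (fromℕ< p) (fromℕ< q)
  ... | _     | _     = + 0                -- never used for j,k ∈ I

  bmat : ∀ {rt} → (Fin rt → Fin rt → ℤ) → ℤ → ℤ → ℚ
  bmat Ct j k =
    (entry Ct (absI k) (absI j) ℚ./ 2) ℚ.* ⟪ s ⟫
    where
    M = + m
    s : ℤ
    s =    ε j ℤ.* ⟦ j ℤ.≟ k ⁺ ⟧
       ℤ.- ε k ℤ.* ⟦ j ⁺ ℤ.≟ k ⟧
       ℤ.+ ε j ℤ.* ⟦ k ℤ.<? j ⟧ ℤ.* ⟦ j ℤ.<? k ⁺ ⟧ ℤ.* ⟦ + 0 ℤ.<? j ⟧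
       ℤ.- ε (j ⁺) ℤ.* ⟦ k ℤ.<? j ⁺ ⟧ ℤ.* ⟦ j ⁺ ℤ.<? k ⁺ ⟧ ℤ.* ⟦ j ⁺ ℤ.≤? M ⟧
       ℤ.- ε k ℤ.* ⟦ j ℤ.<? k ⟧ ℤ.* ⟦ k ℤ.<? j ⁺ ⟧ ℤ.* ⟦ + 0 ℤ.<? k ⟧
       ℤ.+ ε (k ⁺) ℤ.* ⟦ j ℤ.<? k ⁺ ⟧ ℤ.* ⟦ k ⁺ ℤ.<? j ⁺ ⟧ ℤ.* ⟦ k ⁺ ℤ.≤? M ⟧

  UnfrozenRowsFullRank : ∀ {rt} → (Fin rt → Fin rt → ℤ) → Set
  UnfrozenRowsFullRank {rt} Ct =
    ∀ (y : Fin m → ℚ) →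
    (∀ k → InI rt k →
       ∑ℚ (λ j → ⟪ ⟦ idx j ⁺ ℤ.≤? + m ⟧ ⟫ ℚ.* y j ℚ.* bmat Ct (idx j) k) ≡ 0ℚ) →
    ∀ j → ¬ Frozen (idx j) → y j ≡ 0ℚ

-- The argument is triangularity.  Every position J of 𝐢 has a
-- predecessor k ∈ I: the last earlier position with the same label
-- |i_J|, or the frozen index -|i_J| if there is none; then k⁺ = J.
-- In the column k of B the row J carries b_{Jk} = (C_{cc}/2)·ε_J = ±1
-- (c = |i_J|), while every row j > J vanishes.  So if y is a relation
-- among the unfrozen rows and y vanishes on all unfrozen rows before J,
-- the column-k equation reads ±y_J = 0; well-founded induction on the
-- position then kills every coefficient.
--
-- The triangularity argument is carried out
-- for every extended matrix whose diagonal entries on the labels of W are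
-- 2, and the theorem follows because extC restricts to the Cartan matrix
-- C on those labels.

module Submission where

open import Defs
open import Data.Nat using (ℕ; _∸_; _+_)
open import Data.Integer using (ℤ)
open import Data.Fin using (Fin)
open import Data.List using (List)
open import Data.Product using (proj₁)

open import Data.Bool using (Bool; true; false; _∧_)
open import Data.Fin as Fin using (toℕ; fromℕ<)
import Data.Fin.Induction as Finᵢ
import Data.Fin.Properties as Finₚ
open import Data.Integer as ℤ using (+_; -[1+_]; +[1+_])
import Data.Integer.Properties as ℤₚ
open import Data.List using ([]; _∷_; length; map; applyUpTo)
open import Data.Maybe using (just; nothing)
open import Data.Maybe.Properties using (just-injective)
open import Data.Nat as ℕ using (zero; suc)
import Data.Nat.Properties as ℕₚ
open import Data.Product using (Σ; _,_)
open import Data.Rational as ℚ using (ℚ; 0ℚ; 1ℚ)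
import Data.Rational.Properties as ℚₚ
open import Data.Sum using (_⊎_; inj₁; inj₂)
open import Induction.WellFounded as WF using (WfRec)
open import Level using (0ℓ)
open import Relation.Binary.Definitions using (tri<; tri≈; tri>)
open import Relation.Binary.PropositionalEquality
  using (_≡_; _≢_; refl; sym; trans; cong; cong₂; subst; module ≡-Reasoning)
open import Relation.Nullary using (¬_; Dec; yes; no; contradiction)
open import Relation.Nullary.Decidable using (⌊_⌋)

∑ℚ-zero : ∀ {n} (f : Fin n → ℚ) → (∀ j → f j ≡ 0ℚ) → ∑ℚ f ≡ 0ℚ
∑ℚ-zero {zero}  f _     = refl
∑ℚ-zero {suc n} f zeros =
  cong₂ ℚ._+_ (zeros Fin.zero) (∑ℚ-zero (λ j → f (Fin.suc j)) (λ j → zeros (Fin.suc j)))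

∑ℚ-single : ∀ {n} (f : Fin n → ℚ) (i : Fin n) →
  (∀ j → j ≢ i → f j ≡ 0ℚ) → ∑ℚ f ≡ f i
∑ℚ-single {suc n} f Fin.zero others = begin
    f Fin.zero ℚ.+ ∑ℚ (λ j → f (Fin.suc j)) ≡⟨ cong (f Fin.zero ℚ.+_) tail ⟩
    f Fin.zero ℚ.+ 0ℚ                       ≡⟨ ℚₚ.+-identityʳ (f Fin.zero) ⟩
    f Fin.zero                              ∎
  where
  open ≡-Reasoning
  tail : ∑ℚ (λ j → f (Fin.suc j)) ≡ 0ℚ
  tail = ∑ℚ-zero (λ j → f (Fin.suc j)) (λ j → others (Fin.suc j) (λ ()))
∑ℚ-single {suc n} f (Fin.suc i) others = begin
    f Fin.zero ℚ.+ ∑ℚ (λ j → f (Fin.suc j)) ≡⟨ cong₂ ℚ._+_ (others Fin.zero (λ ())) tail ⟩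
    0ℚ ℚ.+ f (Fin.suc i)                    ≡⟨ ℚₚ.+-identityˡ (f (Fin.suc i)) ⟩
    f (Fin.suc i)                           ∎
  where
  open ≡-Reasoning
  tail : ∑ℚ (λ j → f (Fin.suc j)) ≡ f (Fin.suc i)
  tail = ∑ℚ-single (λ j → f (Fin.suc j)) i
           (λ j j≢i → others (Fin.suc j) (λ e → j≢i (Finₚ.suc-injective e)))

cancel-unit : ∀ y u → u ℚ.* u ≡ 1ℚ → y ℚ.* u ≡ 0ℚ → y ≡ 0ℚ
cancel-unit y u u²≡1 yu≡0 = begin
  y                 ≡⟨ sym (ℚₚ.*-identityʳ y) ⟩
  y ℚ.* 1ℚ          ≡⟨ cong (y ℚ.*_) (sym u²≡1) ⟩
  y ℚ.* (u ℚ.* u)   ≡⟨ sym (ℚₚ.*-assoc y u u) ⟩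
  (y ℚ.* u) ℚ.* u   ≡⟨ cong (ℚ._* u) yu≡0 ⟩
  0ℚ ℚ.* u          ≡⟨ ℚₚ.*-zeroˡ u ⟩
  0ℚ                ∎
  where open ≡-Reasoning

⌊⌋-true : ∀ {P : Set} (d : Dec P) → P → ⌊ d ⌋ ≡ true
⌊⌋-true (yes _) _ = refl
⌊⌋-true (no ¬p) p = contradiction p ¬p

⌊⌋-false : ∀ {P : Set} (d : Dec P) → ¬ P → ⌊ d ⌋ ≡ false
⌊⌋-false (yes p) ¬p = contradiction p ¬p
⌊⌋-false (no _) _ = refl

⌊⌋∧-witness : ∀ {P : Set} (d : Dec P) b → ⌊ d ⌋ ∧ b ≡ true → P
⌊⌋∧-witness (yes p) _ _ = p

-[1+]-bounded : ∀ {c n} → c ℕ.< n → ℤ.- (+ n) ℤ.≤ -[1+ c ]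
-[1+]-bounded (ℕ.s≤s c≤n) = ℤ.-≤- c≤n

nth-defined : ∀ {A : Set} (xs : List A) p → p ℕ.< length xs →
  Σ A (λ a → nth xs p ≡ just a)
nth-defined (x ∷ xs) zero    _          = x , refl
nth-defined (x ∷ xs) (suc p) (ℕ.s≤s lt) = nth-defined xs p lt

nth-map-applyUpTo : ∀ {A B : Set} (h : A → B) (g : ℕ → A) n q → q ℕ.< n →
  nth (map h (applyUpTo g n)) q ≡ just (h (g q))
nth-map-applyUpTo h g (suc n) zero    _          = refl
nth-map-applyUpTo h g (suc n) (suc q) (ℕ.s≤s lt) =
  nth-map-applyUpTo h (λ x → g (suc x)) n q lt

-- The integer s in  b_{jk} = (C_{|i_k||i_j|}/2)·s  is a signed sum of six
-- terms; naming the shape lets us rewrite the terms one by one.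
sixTerms : ℤ → ℤ → ℤ → ℤ → ℤ → ℤ → ℤ
sixTerms a b c d e f = a ℤ.- b ℤ.+ c ℤ.- d ℤ.- e ℤ.+ f

sixTerms-cong : ∀ {a b c d e f a' b' c' d' e' f'} →
  a ≡ a' → b ≡ b' → c ≡ c' → d ≡ d' → e ≡ e' → f ≡ f' →
  sixTerms a b c d e f ≡ sixTerms a' b' c' d' e' f'
sixTerms-cong refl refl refl refl refl refl = refl

sixTerms-first : ∀ a → sixTerms a (+ 0) (+ 0) (+ 0) (+ 0) (+ 0) ≡ a
sixTerms-first a
  rewrite ℤₚ.+-identityʳ a | ℤₚ.+-identityʳ a | ℤₚ.+-identityʳ a
        | ℤₚ.+-identityʳ a | ℤₚ.+-identityʳ a = refl

module _ {r : ℕ} (w : List (Letter r)) where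
  open Seed w

  ⟦⟧-holds : ∀ {P : Set} (d : Dec P) → P → ⟦ d ⟧ ≡ + 1
  ⟦⟧-holds (yes _) _ = refl
  ⟦⟧-holds (no ¬p) p = contradiction p ¬p

  ⟦no⟧ : ∀ x {P : Set} (d : Dec P) → ¬ P → x ℤ.* ⟦ d ⟧ ≡ + 0
  ⟦no⟧ x (yes p) ¬p = contradiction p ¬p
  ⟦no⟧ x (no _) _ = ℤₚ.*-zeroʳ x

  ⟦no⟧₁ : ∀ x {A B D : Set} (a : Dec A) (b : Dec B) (c : Dec D) → ¬ A →
    x ℤ.* ⟦ a ⟧ ℤ.* ⟦ b ⟧ ℤ.* ⟦ c ⟧ ≡ + 0
  ⟦no⟧₁ x a b c ¬a rewrite ⟦no⟧ x a ¬a | ℤₚ.*-zeroˡ ⟦ b ⟧ = ℤₚ.*-zeroˡ ⟦ c ⟧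

  ⟦no⟧₂ : ∀ x {A B D : Set} (a : Dec A) (b : Dec B) (c : Dec D) → ¬ B →
    x ℤ.* ⟦ a ⟧ ℤ.* ⟦ b ⟧ ℤ.* ⟦ c ⟧ ≡ + 0
  ⟦no⟧₂ x a b c ¬b rewrite ⟦no⟧ (x ℤ.* ⟦ a ⟧) b ¬b = ℤₚ.*-zeroˡ ⟦ c ⟧

  ⟦⟧-settled : ∀ {P : Set} (d : Dec P) y b → (P → y ≡ 0ℚ) → ⟪ ⟦ d ⟧ ⟫ ℚ.* y ℚ.* b ≡ 0ℚ
  ⟦⟧-settled (yes p) y b y≡0 rewrite y≡0 p = ℚₚ.*-zeroˡ b
  ⟦⟧-settled (no _)  y b _   rewrite ℚₚ.*-zeroˡ y = ℚₚ.*-zeroˡ b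

  labelAt : ℕ → ℕ
  labelAt q = absI +[1+ q ]

  labelAt<r : ∀ (j : Fin m) → labelAt (toℕ j) ℕ.< r
  labelAt<r j with nth w (toℕ j) | nth-defined w (toℕ j) (Finₚ.toℕ<n j)
  ... | just (neg i) | _ = Finₚ.toℕ<n i
  ... | just (pos i) | _ = Finₚ.toℕ<n i
  ... | nothing      | _ , ()

  ε-unit : ∀ p → ⟪ ε +[1+ p ] ⟫ ℚ.* ⟪ ε +[1+ p ] ⟫ ≡ 1ℚ
  ε-unit p with nth w p
  ... | just (neg _) = refl
  ... | just (pos _) = refl
  ... | nothing      = refl

  firstSuch-sound : ∀ P ls → firstSuch P ls ≡ + suc m ⊎ P (firstSuch P ls) ≡ true
  firstSuch-sound P [] = inj₁ refl
  firstSuch-sound P (l ∷ ls) with P l in eq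
  ... | true  = inj₂ eq
  ... | false = firstSuch-sound P ls

  firstSuch-first : ∀ P ls p x → nth ls p ≡ just x → P x ≡ true →
    (∀ q y → q ℕ.< p → nth ls q ≡ just y → P y ≡ false) → firstSuch P ls ≡ x
  firstSuch-first P (l ∷ ls) zero x eq Px _ rewrite just-injective eq | Px = refl
  firstSuch-first P (l ∷ ls) (suc p) x eq Px earlier
    rewrite earlier zero l (ℕ.s≤s ℕ.z≤n) refl =
    firstSuch-first P ls p x eq Px (λ q y lt → earlier (suc q) y (ℕ.s≤s lt))

  nth-positions : ∀ q → q ℕ.< m → nth positions q ≡ just +[1+ q ]
  nth-positions q = nth-map-applyUpTo +[1+_] (λ x → x) m q

  <⁺ : ∀ k → k ℤ.≤ + m → k ℤ.< k ⁺
  <⁺ k k≤m with firstSuch-sound (λ l → ⌊ k ℤ.<? l ⌋ ∧ ⌊ absI l ℕ.≟ absI k ⌋) positions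
  ... | inj₁ ⁺≡m+1 = subst (k ℤ.<_) (sym ⁺≡m+1) (ℤₚ.≤-<-trans k≤m (ℤ.+<+ (ℕₚ.n<1+n m)))
  ... | inj₂ P⁺    = ⌊⌋∧-witness (k ℤ.<? _) _ P⁺

  record Predecessor (c p : ℕ) : Set where
    field
      index : ℤ
      below : index ℤ.< +[1+ p ]
      label : absI index ≡ c
      gap   : ∀ q → q ℕ.< p → index ℤ.< +[1+ q ] → labelAt q ≢ c
      inI   : index ≡ -[1+ c ] ⊎ + 0 ℤ.< index

  predecessor : ∀ c p → Predecessor c p
  predecessor c zero = record
    { index = -[1+ c ] ; below = ℤ.-<+ ; label = refl ; gap = λ _ () ; inI = inj₁ refl }
  predecessor c (suc p) with labelAt p ℕ.≟ c
  ... | yes labelled = record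
    { index = +[1+ p ] ; below = ℤ.+<+ (ℕₚ.n<1+n (suc p)) ; label = labelled
    ; gap = λ { q (ℕ.s≤s q≤p) (ℤ.+<+ (ℕ.s≤s p<q)) → contradiction q≤p (ℕₚ.<⇒≱ p<q) }
    ; inI = inj₂ (ℤ.+<+ (ℕ.s≤s ℕ.z≤n)) }
  ... | no unlabelled = record
    { index = index ; below = ℤₚ.<-trans below (ℤ.+<+ (ℕₚ.n<1+n (suc p)))
    ; label = label ; gap = gap′ ; inI = inI }
    where
    open Predecessor (predecessor c p)
    gap′ : ∀ q → q ℕ.< suc p → index ℤ.< +[1+ q ] → labelAt q ≢ c
    gap′ q (ℕ.s≤s q≤p) with ℕₚ.m≤n⇒m<n∨m≡n q≤p
    ... | inj₁ q<p  = gap q q<p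
    ... | inj₂ refl = λ _ → unlabelled

  predecessor-∈I : ∀ {rt c p} → c ℕ.< rt → p ℕ.< m → (pr : Predecessor c p) →
    InI rt (Predecessor.index pr)
  predecessor-∈I c<rt p<m pr
    with Predecessor.index pr | Predecessor.below pr | Predecessor.inI pr
  ... | _ | _     | inj₁ refl = inj₁ (ℤ.-<+ , -[1+]-bounded c<rt)
  ... | _ | k<p+1 | inj₂ 0<k  = inj₂ (0<k , ℤₚ.≤-trans (ℤₚ.<⇒≤ k<p+1) (ℤ.+≤+ p<m))

  predecessor-⁺ : ∀ p → p ℕ.< m → (pr : Predecessor (labelAt p) p) →
    Predecessor.index pr ⁺ ≡ +[1+ p ]
  predecessor-⁺ p p<m pr =
    firstSuch-first P positions p +[1+ p ] (nth-positions p p<m) Pp earlier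
    where
    open Predecessor pr
    P : ℤ → Bool
    P l = ⌊ index ℤ.<? l ⌋ ∧ ⌊ absI l ℕ.≟ absI index ⌋
    Pp : P +[1+ p ] ≡ true
    Pp rewrite ⌊⌋-true (index ℤ.<? +[1+ p ]) below
             | ⌊⌋-true (labelAt p ℕ.≟ absI index) (sym label) = refl
    earlier : ∀ q y → q ℕ.< p → nth positions q ≡ just y → P y ≡ false
    earlier q y q<p eq with trans (sym eq) (nth-positions q (ℕₚ.<-trans q<p p<m))
    ... | refl with index ℤ.<? +[1+ q ]
    ... | no  _   = refl
    ... | yes k<q = ⌊⌋-false (labelAt q ℕ.≟ absI index)
                      (λ e → gap q q<p k<q (trans e label))

  bsign : ℤ → ℤ → ℤ
  bsign j k = sixTerms
    (ε j ℤ.* ⟦ j ℤ.≟ k ⁺ ⟧)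
    (ε k ℤ.* ⟦ j ⁺ ℤ.≟ k ⟧)
    (ε j ℤ.* ⟦ k ℤ.<? j ⟧ ℤ.* ⟦ j ℤ.<? k ⁺ ⟧ ℤ.* ⟦ + 0 ℤ.<? j ⟧)
    (ε (j ⁺) ℤ.* ⟦ k ℤ.<? j ⁺ ⟧ ℤ.* ⟦ j ⁺ ℤ.<? k ⁺ ⟧ ℤ.* ⟦ j ⁺ ℤ.≤? + m ⟧)
    (ε k ℤ.* ⟦ j ℤ.<? k ⟧ ℤ.* ⟦ k ℤ.<? j ⁺ ⟧ ℤ.* ⟦ + 0 ℤ.<? k ⟧)
    (ε (k ⁺) ℤ.* ⟦ j ℤ.<? k ⁺ ⟧ ℤ.* ⟦ k ⁺ ℤ.<? j ⁺ ⟧ ℤ.* ⟦ k ⁺ ℤ.≤? + m ⟧)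

  -- In the column k, a row j ≥ k⁺ only sees the term ε_j·[j = k⁺]:
  -- j and j⁺ both lie at or above k⁺ > k, so the other five brackets fail.
  bsign-beyond : ∀ j k → k ℤ.< k ⁺ → k ⁺ ℤ.≤ j → j ℤ.≤ + m →
    bsign j k ≡ ε j ℤ.* ⟦ j ℤ.≟ k ⁺ ⟧
  bsign-beyond j k k<k⁺ k⁺≤j j≤m = trans
    (sixTerms-cong (refl {x = ε j ℤ.* ⟦ j ℤ.≟ k ⁺ ⟧})
      (⟦no⟧ (ε k) (j ⁺ ℤ.≟ k) j⁺≢k)
      (⟦no⟧₂ (ε j) (k ℤ.<? j) (j ℤ.<? k ⁺) (+ 0 ℤ.<? j) j≮k⁺)
      (⟦no⟧₂ (ε (j ⁺)) (k ℤ.<? j ⁺) (j ⁺ ℤ.<? k ⁺) (j ⁺ ℤ.≤? + m) j⁺≮k⁺)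
      (⟦no⟧₁ (ε k) (j ℤ.<? k) (k ℤ.<? j ⁺) (+ 0 ℤ.<? k) j≮k)
      (⟦no⟧₁ (ε (k ⁺)) (j ℤ.<? k ⁺) (k ⁺ ℤ.<? j ⁺) (k ⁺ ℤ.≤? + m) j≮k⁺))
    (sixTerms-first (ε j ℤ.* ⟦ j ℤ.≟ k ⁺ ⟧))
    where
    k⁺<j⁺ : k ⁺ ℤ.< j ⁺
    k⁺<j⁺ = ℤₚ.≤-<-trans k⁺≤j (<⁺ j j≤m)
    j⁺≢k : j ⁺ ≢ k
    j⁺≢k e = ℤₚ.<-asym k<k⁺ (subst (k ⁺ ℤ.<_) e k⁺<j⁺)
    j≮k⁺ : ¬ (j ℤ.< k ⁺)
    j≮k⁺ = ℤₚ.≤⇒≯ k⁺≤j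
    j⁺≮k⁺ : ¬ (j ⁺ ℤ.< k ⁺)
    j⁺≮k⁺ = ℤₚ.<-asym k⁺<j⁺
    j≮k : ¬ (j ℤ.< k)
    j≮k j<k = ℤₚ.<-asym k<k⁺ (ℤₚ.≤-<-trans k⁺≤j j<k)

  bmat-beyond : ∀ {rt} (Ct : Fin rt → Fin rt → ℤ) j k →
    k ℤ.< k ⁺ → k ⁺ ℤ.< j → j ℤ.≤ + m → bmat Ct j k ≡ 0ℚ
  bmat-beyond Ct j k k<k⁺ k⁺<j j≤m = begin
    (entry Ct (absI k) (absI j) ℚ./ 2) ℚ.* ⟪ bsign j k ⟫
      ≡⟨ cong (λ s → (entry Ct (absI k) (absI j) ℚ./ 2) ℚ.* ⟪ s ⟫) s≡0 ⟩
    (entry Ct (absI k) (absI j) ℚ./ 2) ℚ.* 0ℚ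
      ≡⟨ ℚₚ.*-zeroʳ (entry Ct (absI k) (absI j) ℚ./ 2) ⟩
    0ℚ ∎
    where
    open ≡-Reasoning
    s≡0 : bsign j k ≡ + 0
    s≡0 = trans (bsign-beyond j k k<k⁺ (ℤₚ.<⇒≤ k⁺<j) j≤m)
                (⟦no⟧ (ε j) (j ℤ.≟ k ⁺) (λ j≡k⁺ → ℤₚ.<⇒≢ k⁺<j (sym j≡k⁺)))

  bmat-successor : ∀ {rt} (Ct : Fin rt → Fin rt → ℤ) J k →
    k ℤ.< J → k ⁺ ≡ J → J ℤ.≤ + m →
    bmat Ct J k ≡ (entry Ct (absI k) (absI J) ℚ./ 2) ℚ.* ⟪ ε J ⟫
  bmat-successor Ct J k k<J k⁺≡J J≤m =
    cong (λ s → (entry Ct (absI k) (absI J) ℚ./ 2) ℚ.* ⟪ s ⟫)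
      (trans (bsign-beyond J k (subst (k ℤ.<_) (sym k⁺≡J) k<J) (ℤₚ.≤-reflexive k⁺≡J) J≤m)
             (trans (cong (ε J ℤ.*_) (⟦⟧-holds (J ℤ.≟ k ⁺) (sym k⁺≡J))) (ℤₚ.*-identityʳ (ε J))))

  unfrozen⇒⁺≤m : ∀ (j : Fin m) → ¬ Frozen (idx j) → idx j ⁺ ℤ.≤ + m
  unfrozen⇒⁺≤m j unfrozen = ℤₚ.≮⇒≥ (λ m<⁺ → unfrozen (inj₂ m<⁺))

  ⁺≤m⇒unfrozen : ∀ (j : Fin m) → idx j ⁺ ℤ.≤ + m → ¬ Frozen (idx j)
  ⁺≤m⇒unfrozen j ⁺≤m (inj₁ (ℤ.+<+ ()))
  ⁺≤m⇒unfrozen j ⁺≤m (inj₂ m<⁺) = ℤₚ.<⇒≱ m<⁺ ⁺≤m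

  module Triangular {rt : ℕ} (Ct : Fin rt → Fin rt → ℤ) (r≤rt : r ℕ.≤ rt)
                    (diagonal : ∀ c → c ℕ.< r → entry Ct c c ≡ + 2) where

    rowTerm : (Fin m → ℚ) → ℤ → Fin m → ℚ
    rowTerm y k j = ⟪ ⟦ idx j ⁺ ℤ.≤? + m ⟧ ⟫ ℚ.* y j ℚ.* bmat Ct (idx j) k

    IsRelation : (Fin m → ℚ) → Set
    IsRelation y = ∀ k → InI rt k → ∑ℚ (rowTerm y k) ≡ 0ℚ

    rowTerm-settled : ∀ y k j → (¬ Frozen (idx j) → y j ≡ 0ℚ) → rowTerm y k j ≡ 0ℚ
    rowTerm-settled y k j settled =
      ⟦⟧-settled (idx j ⁺ ℤ.≤? + m) (y j) (bmat Ct (idx j) k)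
        (λ ⁺≤m → settled (⁺≤m⇒unfrozen j ⁺≤m))

    -- the coefficient of an unfrozen row J vanishes once those of the
    -- earlier unfrozen rows do: test the relation on J's predecessor column
    triangular-step : ∀ y → IsRelation y → ∀ j →
      WfRec Fin._<_ (λ j′ → ¬ Frozen (idx j′) → y j′ ≡ 0ℚ) j →
      ¬ Frozen (idx j) → y j ≡ 0ℚ
    triangular-step y relation j earlier unfrozen =
      cancel-unit (y j) ⟪ ε J ⟫ (ε-unit p) (trans (sym diagonalTerm) columnSum)
      where
      p : ℕ
      p = toℕ j
      J : ℤ
      J = idx j
      pr : Predecessor (labelAt p) p
      pr = predecessor (labelAt p) p
      open Predecessor pr
      k⁺≡J : index ⁺ ≡ J
      k⁺≡J = predecessor-⁺ p (Finₚ.toℕ<n j) pr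
      k<k⁺ : index ℤ.< index ⁺
      k<k⁺ = subst (index ℤ.<_) (sym k⁺≡J) below
      J≤m : J ℤ.≤ + m
      J≤m = ℤ.+≤+ (Finₚ.toℕ<n j)
      kInI : InI rt index
      kInI = predecessor-∈I (ℕₚ.≤-trans (labelAt<r j) r≤rt) (Finₚ.toℕ<n j) pr
      othersVanish : ∀ j′ → j′ ≢ j → rowTerm y index j′ ≡ 0ℚ
      othersVanish j′ j′≢j with ℕₚ.<-cmp (toℕ j′) p
      ... | tri< j′<j _ _ = rowTerm-settled y index j′ (earlier j′<j)
      ... | tri≈ _ j′≡j _ = contradiction (Finₚ.toℕ-injective j′≡j) j′≢j
      ... | tri> _ _ j<j′ =
            trans (cong (⟪ ⟦ idx j′ ⁺ ℤ.≤? + m ⟧ ⟫ ℚ.* y j′ ℚ.*_)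
                    (bmat-beyond Ct (idx j′) index k<k⁺ k⁺<j′ (ℤ.+≤+ (Finₚ.toℕ<n j′))))
                  (ℚₚ.*-zeroʳ (⟪ ⟦ idx j′ ⁺ ℤ.≤? + m ⟧ ⟫ ℚ.* y j′))
            where
            k⁺<j′ : index ⁺ ℤ.< idx j′
            k⁺<j′ = subst (ℤ._< idx j′) (sym k⁺≡J) (ℤ.+<+ (ℕ.s≤s j<j′))
      columnSum : rowTerm y index j ≡ 0ℚ
      columnSum = trans (sym (∑ℚ-single (rowTerm y index) j othersVanish)) (relation index kInI)
      diagonalTerm : rowTerm y index j ≡ y j ℚ.* ⟪ ε J ⟫
      diagonalTerm = begin
        ⟪ ⟦ J ⁺ ℤ.≤? + m ⟧ ⟫ ℚ.* y j ℚ.* bmat Ct J index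
          ≡⟨ cong₂ (λ t b → ⟪ t ⟫ ℚ.* y j ℚ.* b)
               (⟦⟧-holds (J ⁺ ℤ.≤? + m) (unfrozen⇒⁺≤m j unfrozen))
               (bmat-successor Ct J index below k⁺≡J J≤m) ⟩
        1ℚ ℚ.* y j ℚ.* ((entry Ct (absI index) (absI J) ℚ./ 2) ℚ.* ⟪ ε J ⟫)
          ≡⟨ cong (λ e → 1ℚ ℚ.* y j ℚ.* ((e ℚ./ 2) ℚ.* ⟪ ε J ⟫)) entry≡2 ⟩
        1ℚ ℚ.* y j ℚ.* (1ℚ ℚ.* ⟪ ε J ⟫)
          ≡⟨ cong₂ ℚ._*_ (ℚₚ.*-identityˡ (y j)) (ℚₚ.*-identityˡ ⟪ ε J ⟫) ⟩
        y j ℚ.* ⟪ ε J ⟫ ∎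
        where
        open ≡-Reasoning
        entry≡2 : entry Ct (absI index) (absI J) ≡ + 2
        entry≡2 = trans (cong (λ c → entry Ct c (absI J)) label)
                        (diagonal (labelAt p) (labelAt<r j))

    unfrozenRowsIndependent : UnfrozenRowsFullRank Ct
    unfrozenRowsIndependent y relation =
      WF.All.wfRec Finᵢ.<-wellFounded 0ℓ (λ j → ¬ Frozen (idx j) → y j ≡ 0ℚ)
        (triangular-step y relation)

extC-diagonal : ∀ {r} (w : List (Letter r)) {n} (C : Fin r → Fin r → ℤ)
  (E : Fin n → Fin r → ℤ) d nz → (∀ i → C i i ≡ + 2) →
  ∀ c → c ℕ.< r → Seed.entry w (extC C E d nz) c c ≡ + 2
extC-diagonal {r} w {n} C E d nz Cᵢᵢ≡2 c c<r with c ℕ.<? (r ℕ.+ n)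
... | no c≮r̃ = contradiction (ℕₚ.≤-trans c<r (ℕₚ.m≤m+n r n)) c≮r̃
... | yes c<r̃
  rewrite Finₚ.splitAt-< r (fromℕ< c<r̃) (subst (ℕ._< r) (sym (Finₚ.toℕ-fromℕ< c<r̃)) c<r) =
  Cᵢᵢ≡2 _

lemma4p13 : (r : ℕ) (C : Fin r → Fin r → ℤ) → IsGCM r C →
    (d : Fin r → ℕ) (sym : IsSymmetrizer r C d) →
    (ρ : ℕ) → HasRank C ρ →
    (E : Fin (r ∸ ρ) → Fin r → ℤ) →
    LinIndepCols (stacked C E) (λ j → j) →
    (w : List (Letter r)) → DoubleReduced C w →
    Seed.UnfrozenRowsFullRank w (extC C E d (proj₁ sym))
lemma4p13 r C gcm d symmetrizer ρ _ E _ w _ =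
  Triangular.unfrozenRowsIndependent w (extC C E d (proj₁ symmetrizer))
    (ℕₚ.m≤m+n r (r ∸ ρ))
    (extC-diagonal w C E d (proj₁ symmetrizer) (proj₁ gcm))
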